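{- Let $G$ be a bi-block graph with vertices $v_1,\dots,v_N$ and blocks $K_{m_k,n_k}$ ($k=1,\dots,r$), let $q$ satisfy $q\neq -1$ and $q^2(m_k-1)(n_k-1)\neq 1$ for all $k$, let $\mathscr{D}$ be the $q$-distance matrix of $G$, and let $\mathbf{x}$ be the vector defined below. Then $$\sum_{i=1}^{N}\left(1+q+(q^2-1)\mathscr{D}_{iN}\right)\mathbf{x}_i=q+1.$$
   Context: $q$ is a real or complex number (the paper calls it an indeterminate). For an integer $\alpha\ge1$, $[\alpha]=1+q+\cdots+q^{\alpha-1}$, $[0]=0$; the $q$-distance matrix $\mathscr{D}$ of a connected graph with vertices $v_1,\dots,v_N$ has $(i,j)$ entry $\mathscr{D}_{ij}=[d(v_i,v_j)]$, $d$ the shortest-path distance. A block is a maximal connected subgraph without a cut-vertex. A bi-block graph is a connected graph each of whose blocks is a complete bipartite graph; its blocks are $K_{m_k,n_k}$, $k=1,\dots,r$, and in each block a bipartition $X_k\cup Y_k$ with $|X_k|=m_k$, $|Y_k|=n_k$ is fixed. For a vertex $v$ let $\hat d(v)$ be the number of blocks containing $v$, and put $\Delta_k=q^2(m_k-1)(n_k-1)-1$. The vector $\mathbf{x}\in\mathbb{C}^N$ is defined by $$\mathbf{x}(v)=\sum_{k:\,v\in X_k}\frac{q(n_k-1)-1}{(q+1)\Delta_k}+\sum_{k:\,v\in Y_k}\frac{q(m_k-1)-1}{(q+1)\Delta_k}-(\hat d(v)-1),$$ and $\mathbf{x}_i=\mathbf{x}(v_i)$. The vertex ordering $v_1,\dots,v_N$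 is arbitrary. -}

module Defs where

open import Level using (Level; _⊔_) renaming (suc to lsuc)
open import Data.Nat using (ℕ; zero; suc)
open import Data.Bool using (Bool; true; false; _∧_; _∨_; if_then_else_)
open import Data.Fin using (Fin; zero; suc; _≟_)
open import Data.Fin.Subset using (Subset; Side; inside; outside; _∈_; _∉_; _⊆_; _∪_; ∣_∣; Nonempty) renaming (_-_ to _∖_; ⊤ to fullSet)
open import Data.Vec using (lookup)
open import Data.Product using (Σ; ∃; _×_; _,_)
open import Data.Sum using (_⊎_)
open import Relation.Nullary using (¬_; does)
open import Relation.Binary.PropositionalEquality using (_≡_)
open import Function.Bundles using (_⇔_)
open import Algebra.Bundles using (CommutativeRing)

-- Fields (not in agda-stdlib): a commutative ring with 0 ≠ 1 and a
-- total inverse function that is a genuine inverse on nonzero elements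
-- (the value of 0⁻¹ is irrelevant).  ℝ and ℂ are instances.

record Field (c ℓ : Level) : Set (lsuc (c ⊔ ℓ)) where
  field
    commutativeRing : CommutativeRing c ℓ
  open CommutativeRing commutativeRing public
  field
    _⁻¹        : Carrier → Carrier
    ⁻¹-inverse : ∀ x → ¬ (x ≈ 0#) → (x * x ⁻¹) ≈ 1#
    0≉1        : ¬ (0# ≈ 1#)

record IsSimpleGraph {N : ℕ} (adj : Fin N → Fin N → Bool) : Set where
  field
    symmetric   : ∀ u v → adj u v ≡ adj v u
    irreflexive : ∀ v → adj v v ≡ false

module _ {N : ℕ} (adj : Fin N → Fin N → Bool) where

  data WalkIn (S : Subset N) : Fin N → Fin N → Set where
    here : ∀ {u} → u ∈ S → WalkIn S u u
    step : ∀ {u w v} → u ∈ S → adj u w ≡ true → WalkIn S w v → WalkIn S u v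

  ConnectedIn : Subset N → Set
  ConnectedIn S = ∀ {u v} → u ∈ S → v ∈ S → WalkIn S u v

  NoCutVertexIn : Subset N → Set
  NoCutVertexIn S = ∀ c → c ∈ S → ConnectedIn (S ∖ c)

  IsBlock : Subset N → Set
  IsBlock S = Nonempty S × ConnectedIn S × NoCutVertexIn S
            × (∀ T → S ⊆ T → ConnectedIn T → NoCutVertexIn T → T ⊆ S)

  Connected : Set
  Connected = ∀ (u v : Fin N) → WalkIn fullSet u v

  IsCompleteBipartiteOn : Subset N → Subset N → Set
  IsCompleteBipartiteOn X Y =
      (∀ v → v ∈ X → v ∉ Y)
    × (∀ u v → u ∈ X ∪ Y → v ∈ X ∪ Y →
         (adj u v ≡ true) ⇔ ((u ∈ X × v ∈ Y) ⊎ (u ∈ Y × v ∈ X)))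

  record IsBiBlockGraph (r : ℕ) (X Y : Fin r → Subset N) : Set where
    field
      simple      : IsSimpleGraph adj
      connected   : Connected
      blockIsBlk  : ∀ k → IsBlock (X k ∪ Y k)
      blockBip    : ∀ k → IsCompleteBipartiteOn (X k) (Y k)
      allBlocks   : ∀ S → IsBlock S → ∃ λ k → S ≡ X k ∪ Y k
      distinct    : ∀ k l → X k ∪ Y k ≡ X l ∪ Y l → k ≡ l

  anyFin : ∀ {n} → (Fin n → Bool) → Bool
  anyFin {zero}  f = false
  anyFin {suc n} f = f zero ∨ anyFin (λ i → f (suc i))

  reach : ℕ → Fin N → Fin N → Bool
  reach zero    u v = does (u ≟ v)
  reach (suc k) u v = reach k u v ∨ anyFin (λ w → reach k u w ∧ adj w v)

  dist : Fin N → Fin N → ℕ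
  dist u v = go N 0
    where
    go : ℕ → ℕ → ℕ
    go zero    k = k
    go (suc f) k = if reach k u v then k else go f (suc k)

module FieldDefs {c ℓ : Level} (F : Field c ℓ) where
  open Field F using (Carrier; _+_; _*_; _-_; 0#; 1#; _⁻¹)

  natF : ℕ → Carrier
  natF zero    = 0#
  natF (suc n) = 1# + natF n

  qnum : Carrier → ℕ → Carrier
  qnum q zero    = 0#
  qnum q (suc a) = 1# + q * qnum q a

  Σᶠ : ∀ {n} → (Fin n → Carrier) → Carrier
  Σᶠ {zero}  f = 0#
  Σᶠ {suc n} f = f zero + Σᶠ (λ i → f (suc i))

  countIn : ∀ {N r} → (Fin r → Subset N) → Fin N → ℕ
  countIn {r = zero}  S v = 0
  countIn {r = suc r} S v with lookup (S zero) v
  ... | inside  = suc (countIn (λ k → S (suc k)) v)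
  ... | outside = countIn (λ k → S (suc k)) v

  when∈ : ∀ {N} → Fin N → Subset N → Carrier → Carrier
  when∈ v S a with lookup S v
  ... | inside  = a
  ... | outside = 0#

  module _ (q : Carrier) {N r : ℕ} (X Y : Fin r → Subset N) where
    m n : Fin r → Carrier
    m k = natF ∣ X k ∣
    n k = natF ∣ Y k ∣

    Δ : Fin r → Carrier
    Δ k = q * q * (m k - 1#) * (n k - 1#) - 1#

    dhat : Fin N → ℕ
    dhat = countIn (λ k → X k ∪ Y k)

    xvec : Fin N → Carrier
    xvec v =
        Σᶠ (λ k → when∈ v (X k) ((q * (n k - 1#) - 1#) * ((q + 1#) * Δ k) ⁻¹))
      + Σᶠ (λ k → when∈ v (Y k) ((q * (m k - 1#) - 1#) * ((q + 1#) * Δ k) ⁻¹))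
      - (natF (dhat v) - 1#)

-- Root the graph at ρ = v_N and write d v for the distance from v to ρ. Since
-- 1 + q + (q² − 1)[d] = (q + 1) q^d, it suffices to show Σ_v q^(d v) x(v) = 1.
-- Every block has a unique vertex c nearest to ρ: a closer neighbour outside the block at any
-- other vertex would yield a walk leaving the block and re-entering it elsewhere, against the
-- maximality of blocks. The opposite side of c then lies at distance d c + 1 and the rest of
-- its own side at d c + 2, and the block weights of x are chosen exactly so that the block
-- contributes q^(d c). Each vertex v ≠ ρ lies in exactly one block of which it is not the
-- nearest vertex, so d̂(v) − 1 counts the blocks hanging from v, minus one at ρ; this part of x
-- contributes q^(d ρ) − Σ_blocks q^(d c), and the total is 1.

module Submission where

open import Defs
open import Level using (Level)
open import Data.Nat using (ℕ; zero; suc; _≤_; _<_; z≤n; s≤s)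
import Data.Nat.Properties as ℕ
open import Data.Nat.Properties
  using (≤-refl; ≤-trans; ≤-pred; ≤-reflexive; <-irrefl; <-≤-trans; ≤∧≢⇒<; m≤n⇒m≤1+n; +-suc; suc-injective; 0≢1+n; <-trans; +-monoˡ-≤; m≤n+m; n≤0⇒n≡0; ≤-antisym)
open import Data.Bool using (Bool; true; false; T; _∧_; if_then_else_)
open import Data.Bool.Properties using (T-∨; T-∧; T-≡)
open import Data.Fin using (Fin; zero; suc; fromℕ; _≟_)
open import Data.Fin.Properties using (injective⇒≤; any?)
open import Data.Vec using ([]; _∷_; here; there)
open import Data.Vec.Properties using ([]=⇒lookup; lookup⇒[]=)
open import Data.Fin.Subset using (Subset; _∈_; _∉_; _⊆_; _⊂_; _∪_; _─_; ⁅_⁆; ∣_∣; Nonempty; inside) renaming (_-_ to _∖_)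
open import Data.Fin.Subset.Properties using (x∈p∪q⁺; x∈p∪q⁻; x∈⁅x⁆; x∈⁅y⁆⇒x≡y; ∉⊥; p─q⊆p; x∈p∧x≢y⇒x∈p-y; ⊆-refl; ⊆-antisym; ∪-comm; ∣⁅x⁆∣≡1; ∣p∣≤n; p⊂q⇒∣p∣<∣q∣)
  renaming (_∈?_ to _∈ˢ?_)
open import Data.List using (List; []; _∷_; _++_; length; lookup; filter; allFin)
open import Data.List.Extrema.Nat using (argmin; argmin-all; f[argmin]≤f[xs])
open import Data.List.Properties using (length-++)
open import Data.List.Membership.Propositional using () renaming (_∈_ to _∈ₗ_; _∉_ to _∉ₗ_)
open import Data.List.Membership.Propositional.Properties using (∈-lookup; ∈-∃++; ∈-++⁻; ∈-++⁺ˡ; ∈-++⁺ʳ; ∈-filter⁺; ∈-allFin)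
open import Data.List.Relation.Binary.Subset.Propositional using () renaming (_⊆_ to _⊆ₗ_)
open import Data.List.Relation.Unary.Any using (here; there)
open import Data.List.Relation.Unary.All as All using (All; []; _∷_)
open import Data.List.Relation.Unary.All.Properties using (¬Any⇒All¬; all-filter) renaming (++⁺ to All-++⁺)
open import Data.List.Relation.Unary.Unique.Propositional using (Unique; []; _∷_)
open import Data.List.Relation.Unary.Unique.Propositional.Properties using (Unique[x∷xs]⇒x∉xs)
open import Data.Product using (Σ; ∃; _×_; _,_; proj₁; proj₂)
open import Data.Sum as Sum using (_⊎_; inj₁; inj₂)
open import Data.Empty using (⊥; ⊥-elim)
open import Function using (_∘_)
open import Function.Bundles using (Equivalence; mk⇔)
open import Relation.Nullary using (¬_; yes; no)
open import Relation.Nullary.Decidable using (dec-true; decidable-stable; ¬¬-excluded-middle; _×-dec_)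
import Algebra.Bundles
open import Relation.Binary.PropositionalEquality using (_≡_; _≢_; refl; sym; trans; cong; cong₂; subst)

open Equivalence using (to; from)

x∈p─q⇒x∉q : ∀ {n} {p q : Subset n} {x} → x ∈ p ─ q → x ∉ q
x∈p─q⇒x∉q {p = _ ∷ _} {_ ∷ _} (there x∈) (there x∈q) = x∈p─q⇒x∉q x∈ x∈q
x∈p─q⇒x∉q {p = _ ∷ _} {inside ∷ _} {zero} () _

x∈p-y⁻ : ∀ {n} {p : Subset n} {x y} → x ∈ p ∖ y → x ∈ p × x ≢ y
x∈p-y⁻ {p = p} {y = y} x∈ =
  p─q⊆p p ⁅ y ⁆ x∈ , λ { refl → x∈p─q⇒x∉q x∈ (x∈⁅x⁆ y) }

unique-length≤ : ∀ {n} {xs : List (Fin n)} → Unique xs → length xs ≤ n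
unique-length≤ u = injective⇒≤ (lookup-injective u)
  where
  lookup-injective : ∀ {n} {xs : List (Fin n)} → Unique xs → ∀ {i j} → lookup xs i ≡ lookup xs j → i ≡ j
  lookup-injective (_ ∷ _) {zero} {zero} _ = refl
  lookup-injective (x≢ ∷ _) {zero} {suc j} e = ⊥-elim (All.lookup x≢ (∈-lookup j) e)
  lookup-injective (x≢ ∷ _) {suc i} {zero} e = ⊥-elim (All.lookup x≢ (∈-lookup i) (sym e))
  lookup-injective (_ ∷ u) {suc i} {suc j} e = cong suc (lookup-injective u e)

unique-middle : ∀ {A : Set} (xs : List A) {x ys} → Unique (xs ++ x ∷ ys) → x ∉ₗ xs × x ∉ₗ ys
unique-middle [] u = (λ ()) , Unique[x∷xs]⇒x∉xs u
unique-middle (y ∷ xs) (y≢ ∷ u) =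
  (λ { (here refl) → All.lookup y≢ (∈-++⁺ʳ xs (here refl)) refl ; (there x∈) → proj₁ (unique-middle xs u) x∈ })
  , proj₂ (unique-middle xs u)

unique-suffix : ∀ {A : Set} (xs : List A) {ys} → Unique (xs ++ ys) → Unique ys
unique-suffix [] u = u
unique-suffix (_ ∷ xs) (_ ∷ u) = unique-suffix xs u

record IsLeastSearch (P : ℕ → Bool) (g : ℕ → ℕ → ℕ) : Set where
  field
    exhausted : ∀ k → g 0 k ≡ k
    next      : ∀ f k → g (suc f) k ≡ (if P k then k else g f (suc k))

module LeastSearch {P : ℕ → Bool} {g : ℕ → ℕ → ℕ} (isSearch : IsLeastSearch P g) where
  open IsLeastSearch isSearch
  open Data.Nat using (_+_)

  search-least : ∀ f {k j} → k ≤ j → T (P j) → g f k ≤ j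
  search-least zero {k} k≤j _ = subst (_≤ _) (sym (exhausted k)) k≤j
  search-least (suc f) {k} {j} k≤j Pj rewrite next f k with P k in Pk | k Data.Nat.≟ j
  ... | true  | _        = k≤j
  ... | false | yes refl = ⊥-elim (subst T Pk Pj)
  ... | false | no k≢j   = search-least f (≤∧≢⇒< k≤j k≢j) Pj

  search-found : ∀ f k → T (P (f + k)) → T (P (g f k))
  search-found zero k Pk rewrite exhausted k = Pk
  search-found (suc f) k Pf rewrite next f k with P k in Pk
  ... | true  = subst T (sym Pk) _
  ... | false = search-found f (suc k) (subst (T ∘ P) (sym (+-suc f k)) Pf)

toSubset : ∀ {n} → List (Fin n) → Subset n
toSubset []       = Data.Fin.Subset.⊥
toSubset (x ∷ xs) = ⁅ x ⁆ ∪ toSubset xs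

∈-toSubset⁺ : ∀ {n} {xs : List (Fin n)} {x} → x ∈ₗ xs → x ∈ toSubset xs
∈-toSubset⁺ {xs = x ∷ _} (here refl) = x∈p∪q⁺ (inj₁ (x∈⁅x⁆ x))
∈-toSubset⁺ (there x∈)              = x∈p∪q⁺ (inj₂ (∈-toSubset⁺ x∈))

∈-toSubset⁻ : ∀ {n} {xs : List (Fin n)} {x} → x ∈ toSubset xs → x ∈ₗ xs
∈-toSubset⁻ {xs = []} x∈ = ⊥-elim (∉⊥ x∈)
∈-toSubset⁻ {xs = y ∷ xs} x∈ with x∈p∪q⁻ ⁅ y ⁆ (toSubset xs) x∈
... | inj₁ x∈⁅y⁆ = here (x∈⁅y⁆⇒x≡y y x∈⁅y⁆)
... | inj₂ x∈xs  = there (∈-toSubset⁻ x∈xs)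

module Walks {N : ℕ} (adj : Fin N → Fin N → Bool) where

  open import Data.List.Membership.DecPropositional (_≟_ {N}) using (_∈?_)

  Adj : Fin N → Fin N → Set
  Adj u v = adj u v ≡ true

  infixr 5 _◅_ _◅◅_

  data Walk : Fin N → List (Fin N) → Fin N → Set where
    ε   : ∀ {u} → Walk u [] u
    _◅_ : ∀ {u w xs v} → Adj u w → Walk w xs v → Walk u (w ∷ xs) v

  _◅◅_ : ∀ {u xs v ys w} → Walk u xs v → Walk v ys w → Walk u (xs ++ ys) w
  ε       ◅◅ q = q
  (a ◅ p) ◅◅ q = a ◅ (p ◅◅ q)

  splitWalk : ∀ xs {u ys w} → Walk u (xs ++ ys) w → ∃ λ v → Walk u xs v × Walk v ys w
  splitWalk []       p = _ , ε , p
  splitWalk (_ ∷ xs) (a ◅ p) with splitWalk xs p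
  ... | v , p₁ , p₂ = v , a ◅ p₁ , p₂

  walk-end : ∀ {u xs v} → Walk u xs v → v ≡ u ⊎ v ∈ₗ xs
  walk-end ε       = inj₁ refl
  walk-end (a ◅ p) with walk-end p
  ... | inj₁ refl = inj₂ (here refl)
  ... | inj₂ v∈   = inj₂ (there v∈)

  shortcut : ∀ {u xs v} → Walk u xs v → ∃ λ ys → Walk u ys v × Unique (u ∷ ys) × ys ⊆ₗ xs
  shortcut ε = [] , ε , [] ∷ [] , λ ()
  shortcut {u} (_◅_ {w = w} a p) with shortcut p
  ... | ys , p′ , uq , ys⊆ with u ∈? (w ∷ ys)
  ...   | no u∉ = w ∷ ys , a ◅ p′ , ¬Any⇒All¬ _ u∉ ∷ uq
                , λ { (here e) → here e ; (there y∈) → there (ys⊆ y∈) }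
  ...   | yes (here refl) = ys , p′ , uq , there ∘ ys⊆
  ...   | yes (there u∈) with ∈-∃++ u∈
  ...     | pre , post , refl with splitWalk pre p′
  ...       | _ , _ , _ ◅ p″ = post , p″ , unique-suffix (w ∷ pre) uq , there ∘ ys⊆ ∘ ∈-++⁺ʳ pre ∘ there

  walkIn-start : ∀ {S u v} → WalkIn adj S u v → u ∈ S
  walkIn-start (here u∈)     = u∈
  walkIn-start (step u∈ _ _) = u∈

  walkIn-mono : ∀ {S S′ u v} → S ⊆ S′ → WalkIn adj S u v → WalkIn adj S′ u v
  walkIn-mono S⊆ (here u∈)     = here (S⊆ u∈)
  walkIn-mono S⊆ (step u∈ a p) = step (S⊆ u∈) a (walkIn-mono S⊆ p)

  _◅◅ⁱ_ : ∀ {S u v w} → WalkIn adj S u v → WalkIn adj S v w → WalkIn adj S u w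
  here _       ◅◅ⁱ q = q
  step u∈ a p ◅◅ⁱ q = step u∈ a (p ◅◅ⁱ q)

  toWalkIn : ∀ {S u xs v} → Walk u xs v → u ∈ S → All (_∈ S) xs → WalkIn adj S u v
  toWalkIn ε       u∈ []         = here u∈
  toWalkIn (a ◅ p) u∈ (w∈ ∷ xs∈) = step u∈ a (toWalkIn p w∈ xs∈)

  fromWalkIn : ∀ {S u v} → WalkIn adj S u v → ∃ λ xs → Walk u xs v × All (_∈ S) xs
  fromWalkIn (here _) = [] , ε , []
  fromWalkIn (step _ a p) with fromWalkIn p
  ... | xs , p′ , xs∈ = _ ∷ xs , a ◅ p′ , walkIn-start p ∷ xs∈

  walkIn-toVertex : ∀ {S u xs v y} → Walk u xs v → u ∈ S → All (_∈ S) xs → y ∈ₗ xs → WalkIn adj S u y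
  walkIn-toVertex (a ◅ p) u∈ (w∈ ∷ _)   (here refl) = step u∈ a (here w∈)
  walkIn-toVertex (a ◅ p) u∈ (w∈ ∷ xs∈) (there y∈)  = step u∈ a (walkIn-toVertex p w∈ xs∈ y∈)

  walkIn-fromVertex : ∀ {S u xs v y} → Walk u xs v → All (_∈ S) xs → y ∈ₗ xs → WalkIn adj S y v
  walkIn-fromVertex (a ◅ p) (w∈ ∷ xs∈) (here refl) = toWalkIn p w∈ xs∈
  walkIn-fromVertex (a ◅ p) (_ ∷ xs∈)  (there y∈)  = walkIn-fromVertex p xs∈ y∈

  -- A record rather than T (reach adj k u v), so that k, u and v can be inferred.
  record Reach (k : ℕ) (u v : Fin N) : Set where
    constructor reached
    field reached? : T (reach adj k u v)

  anyFin⁺ : ∀ {n} (f : Fin n → Bool) w → T (f w) → T (anyFin adj f)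
  anyFin⁺ f zero    fw = from (T-∨ {f zero}) (inj₁ fw)
  anyFin⁺ f (suc w) fw = from (T-∨ {f zero}) (inj₂ (anyFin⁺ (f ∘ suc) w fw))

  anyFin⁻ : ∀ {n} (f : Fin n → Bool) → T (anyFin adj f) → ∃ λ w → T (f w)
  anyFin⁻ {suc n} f any with to (T-∨ {f zero}) any
  ... | inj₁ f0   = zero , f0
  ... | inj₂ any′ with anyFin⁻ (f ∘ suc) any′
  ...   | w , fw = suc w , fw

  reach-zero⁻ : ∀ {u v} → Reach 0 u v → u ≡ v
  reach-zero⁻ {u} {v} (reached r) with u ≟ v
  ... | yes u≡v = u≡v

  reach-suc : ∀ {k u v} → Reach k u v ⊎ (∃ λ w → Reach k u w × Adj w v) → Reach (suc k) u v
  reach-suc {k} {u} {v} (inj₁ (reached r)) = reached (from (T-∨ {reach adj k u v}) (inj₁ r))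
  reach-suc {k} {u} {v} (inj₂ (w , reached r , a)) =
    reached (from (T-∨ {reach adj k u v}) (inj₂ (anyFin⁺ _ w (from (T-∧ {reach adj k u w}) (r , from T-≡ a)))))

  reach-suc⁻ : ∀ {k u v} → Reach (suc k) u v → Reach k u v ⊎ (∃ λ w → Reach k u w × Adj w v)
  reach-suc⁻ {k} {u} {v} (reached r) with to (T-∨ {reach adj k u v}) r
  ... | inj₁ r′ = inj₁ (reached r′)
  ... | inj₂ r′ with anyFin⁻ (λ w → reach adj k u w ∧ adj w v) r′
  ...   | w , r″ with to (T-∧ {reach adj k u w}) r″
  ...     | r‴ , a = inj₂ (w , reached r‴ , to T-≡ a)

  reach-refl : ∀ k u → Reach k u u
  reach-refl zero    u = reached (from T-≡ (dec-true (u ≟ u) refl))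
  reach-refl (suc k) u = reach-suc (inj₁ (reach-refl k u))

  reach-cons : ∀ k {u w v} → Adj u w → Reach k w v → Reach (suc k) u v
  reach-cons zero {u} {w} {v} a r with reach-zero⁻ {w} {v} r
  ... | refl = reach-suc (inj₂ (u , reach-refl 0 u , a))
  reach-cons (suc k) a r with reach-suc⁻ r
  ... | inj₁ r′            = reach-suc (inj₁ (reach-cons k a r′))
  ... | inj₂ (x , r′ , ax) = reach-suc (inj₂ (x , reach-cons k a r′ , ax))

  walk⇒reach : ∀ {k u xs v} → Walk u xs v → length xs ≤ k → Reach k u v
  walk⇒reach {k} {u} ε _           = reach-refl k u
  walk⇒reach {suc k} (a ◅ p) (s≤s l) = reach-cons k a (walk⇒reach p l)

  reach⇒walk : ∀ k {u v} → Reach k u v → ∃ λ xs → Walk u xs v × length xs ≤ k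
  reach⇒walk zero {u} {v} r with reach-zero⁻ {u} {v} r
  ... | refl = [] , ε , z≤n
  reach⇒walk (suc k) r with reach-suc⁻ r
  ... | inj₁ r′ with reach⇒walk k r′
  ...   | xs , p , l = xs , p , m≤n⇒m≤1+n l
  reach⇒walk (suc k) {v = v} r | inj₂ (w , r′ , a) with reach⇒walk k r′
  ...   | xs , p , l = xs ++ v ∷ [] , p ◅◅ (a ◅ ε) ,
                       ≤-trans (≤-reflexive (trans (length-++ xs) (ℕ.+-comm (length xs) 1))) (s≤s l)

module UndirectedWalks {N : ℕ} {adj : Fin N → Fin N → Bool} (symmetric : ∀ u v → adj u v ≡ adj v u) where
  open Walks adj

  adj-sym : ∀ {u v} → Adj u v → Adj v u
  adj-sym {u} {v} a = trans (symmetric v u) a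

  walkIn-snoc : ∀ {S u v w} → WalkIn adj S u v → Adj v w → w ∈ S → WalkIn adj S u w
  walkIn-snoc (here v∈)      a w∈ = step v∈ a (here w∈)
  walkIn-snoc (step u∈ a′ p) a w∈ = step u∈ a′ (walkIn-snoc p a w∈)

  walkIn-reverse : ∀ {S u v} → WalkIn adj S u v → WalkIn adj S v u
  walkIn-reverse (here u∈)     = here u∈
  walkIn-reverse (step u∈ a p) = walkIn-snoc (walkIn-reverse p) (adj-sym a) u∈

  reverseWalk : ∀ {u xs v} → Walk u xs v → ∃ λ ys → Walk v ys u × ys ⊆ₗ u ∷ xs
  reverseWalk ε = [] , ε , λ ()
  reverseWalk {u} (a ◅ p) with reverseWalk p
  ... | ys , p′ , ys⊆ = ys ++ u ∷ [] , p′ ◅◅ (adj-sym a ◅ ε) , ⊆u∷xs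
    where
    ⊆u∷xs : ys ++ u ∷ [] ⊆ₗ u ∷ _
    ⊆u∷xs y∈ with ∈-++⁻ ys y∈
    ... | inj₁ y∈ys         = there (ys⊆ y∈ys)
    ... | inj₂ (here refl) = here refl

  connectedIn-viaHub : ∀ {S h} → (∀ {y} → y ∈ S → WalkIn adj S y h) → ConnectedIn adj S
  connectedIn-viaHub toHub u∈ v∈ = toHub u∈ ◅◅ⁱ walkIn-reverse (toHub v∈)

module Blocks {N : ℕ} {adj : Fin N → Fin N → Bool} (symmetric : ∀ u v → adj u v ≡ adj v u) where
  open Walks adj
  open UndirectedWalks symmetric
  open Data.Nat using (_+_)

  block-nonempty : ∀ {S} → IsBlock adj S → Nonempty S
  block-nonempty (nonempty , _) = nonempty

  block-connected : ∀ {S} → IsBlock adj S → ConnectedIn adj S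
  block-connected (_ , connected , _) = connected

  block-noCut : ∀ {S} → IsBlock adj S → NoCutVertexIn adj S
  block-noCut (_ , _ , noCut , _) = noCut

  block-maximal : ∀ {S T} → IsBlock adj S → S ⊆ T → ConnectedIn adj T → NoCutVertexIn adj T → T ⊆ S
  block-maximal (_ , _ , _ , maximal) = maximal _

  ∖-mono : ∀ {S S′ : Subset N} {c} → S ⊆ S′ → S ∖ c ⊆ S′ ∖ c
  ∖-mono S⊆ y∈ with x∈p-y⁻ y∈
  ... | y∈S , y≢c = x∈p∧x≢y⇒x∈p-y (S⊆ y∈S) y≢c

  block-connected∖ : ∀ {S} → IsBlock adj S → ∀ c → ConnectedIn adj (S ∖ c)
  block-connected∖ {S} blk c with c ∈ˢ? S
  ... | yes c∈ = block-noCut blk c c∈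
  ... | no  c∉ = λ u∈ v∈ →
    walkIn-mono (λ y∈ → x∈p∧x≢y⇒x∈p-y y∈ λ { refl → c∉ y∈ })
                (block-connected blk (proj₁ (x∈p-y⁻ u∈)) (proj₁ (x∈p-y⁻ v∈)))

  twoSharedVertices⇒⊆ : ∀ {S₁ S₂ x y} → IsBlock adj S₁ → IsBlock adj S₂ → x ≢ y →
                        x ∈ S₁ → y ∈ S₁ → x ∈ S₂ → y ∈ S₂ → S₂ ⊆ S₁
  twoSharedVertices⇒⊆ {S₁} {S₂} {x} {y} blk₁ blk₂ x≢y x∈₁ y∈₁ x∈₂ y∈₂ =
    block-maximal blk₁ ⊆∪ˡ connected noCut ∘ ⊆∪ʳ
    where
    ⊆∪ˡ : S₁ ⊆ S₁ ∪ S₂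
    ⊆∪ˡ = x∈p∪q⁺ ∘ inj₁
    ⊆∪ʳ : S₂ ⊆ S₁ ∪ S₂
    ⊆∪ʳ = x∈p∪q⁺ ∘ inj₂

    connected : ConnectedIn adj (S₁ ∪ S₂)
    connected = connectedIn-viaHub toX
      where
      toX : ∀ {z} → z ∈ S₁ ∪ S₂ → WalkIn adj (S₁ ∪ S₂) z x
      toX z∈ with x∈p∪q⁻ S₁ S₂ z∈
      ... | inj₁ z∈₁ = walkIn-mono ⊆∪ˡ (block-connected blk₁ z∈₁ x∈₁)
      ... | inj₂ z∈₂ = walkIn-mono ⊆∪ʳ (block-connected blk₂ z∈₂ x∈₂)

    connected∖ : ∀ {c h} → h ∈ S₁ → h ∈ S₂ → h ≢ c → ConnectedIn adj ((S₁ ∪ S₂) ∖ c)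
    connected∖ {c} {h} h∈₁ h∈₂ h≢c = connectedIn-viaHub toH
      where
      toH : ∀ {z} → z ∈ (S₁ ∪ S₂) ∖ c → WalkIn adj ((S₁ ∪ S₂) ∖ c) z h
      toH z∈ with x∈p-y⁻ z∈
      ... | z∈∪ , z≢c with x∈p∪q⁻ S₁ S₂ z∈∪
      ...   | inj₁ z∈₁ = walkIn-mono (∖-mono ⊆∪ˡ)
                           (block-connected∖ blk₁ c (x∈p∧x≢y⇒x∈p-y z∈₁ z≢c) (x∈p∧x≢y⇒x∈p-y h∈₁ h≢c))
      ...   | inj₂ z∈₂ = walkIn-mono (∖-mono ⊆∪ʳ)
                           (block-connected∖ blk₂ c (x∈p∧x≢y⇒x∈p-y z∈₂ z≢c) (x∈p∧x≢y⇒x∈p-y h∈₂ h≢c))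

    noCut : NoCutVertexIn adj (S₁ ∪ S₂)
    noCut c _ with x ≟ c
    ... | yes refl = connected∖ y∈₁ y∈₂ (x≢y ∘ sym)
    ... | no  x≢c  = connected∖ x∈₁ x∈₂ x≢c

  twoSharedVertices⇒≡ : ∀ {S₁ S₂ x y} → IsBlock adj S₁ → IsBlock adj S₂ → x ≢ y →
                        x ∈ S₁ → y ∈ S₁ → x ∈ S₂ → y ∈ S₂ → S₁ ≡ S₂
  twoSharedVertices⇒≡ blk₁ blk₂ x≢y x∈₁ y∈₁ x∈₂ y∈₂ =
    ⊆-antisym (twoSharedVertices⇒⊆ blk₂ blk₁ x≢y x∈₂ y∈₂ x∈₁ y∈₁) (twoSharedVertices⇒⊆ blk₁ blk₂ x≢y x∈₁ y∈₁ x∈₂ y∈₂)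

  -- S together with the vertices of a path from a ∈ S through the outside to b ∈ S would again
  -- be connected without cut vertex, against the maximality of S.
  private
    module Detour {S a b v} (blk : IsBlock adj S) (a∈ : a ∈ S) (b∈ : b ∈ S) (a≢b : a ≢ b) (vb : Adj v b) where
      Ext : List (Fin N) → Subset N
      Ext zs = S ∪ toSubset zs

      S⊆Ext : ∀ {zs} → S ⊆ Ext zs
      S⊆Ext = x∈p∪q⁺ ∘ inj₁

      zs⊆Ext : ∀ {zs y} → y ∈ₗ zs → y ∈ Ext zs
      zs⊆Ext = x∈p∪q⁺ ∘ inj₂ ∘ ∈-toSubset⁺

      Ext⁻ : ∀ {zs y} → y ∈ Ext zs → y ∈ S ⊎ y ∈ₗ zs
      Ext⁻ {zs} y∈ with x∈p∪q⁻ S (toSubset zs) y∈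
      ... | inj₁ y∈S  = inj₁ y∈S
      ... | inj₂ y∈zs = inj₂ (∈-toSubset⁻ y∈zs)

      connected : ∀ {zs} → Walk a zs v → ConnectedIn adj (Ext zs)
      connected {zs} p = connectedIn-viaHub toA
        where
        toA : ∀ {y} → y ∈ Ext zs → WalkIn adj (Ext zs) y a
        toA y∈ with Ext⁻ y∈
        ... | inj₁ y∈S  = walkIn-mono (S⊆Ext {zs}) (block-connected blk y∈S a∈)
        ... | inj₂ y∈zs = walkIn-reverse (walkIn-toVertex p (S⊆Ext {zs} a∈) (All.tabulate (zs⊆Ext {zs})) y∈zs)

      -- Deleting c ∈ S: a path vertex still leaves through whichever of a, b differs from c.
      noCut-S : ∀ {zs c} → Walk a zs v → All (_∉ S) zs → c ∈ S → ConnectedIn adj (Ext zs ∖ c)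
      noCut-S {zs} {c} p outside c∈ = connectedIn-viaHub toHub
        where
        zs∈ : All (_∈ Ext zs ∖ c) zs
        zs∈ = All.tabulate λ y∈ → x∈p∧x≢y⇒x∈p-y (zs⊆Ext y∈) λ { refl → All.lookup outside y∈ c∈ }

        escape : ∀ {y} → y ∈ₗ zs → ∃ λ e → e ∈ S ∖ c × WalkIn adj (Ext zs ∖ c) y e
        escape y∈ with a ≟ c
        ... | no a≢c   = a , x∈p∧x≢y⇒x∈p-y a∈ a≢c
                       , walkIn-reverse (walkIn-toVertex p (∖-mono (S⊆Ext {zs}) (x∈p∧x≢y⇒x∈p-y a∈ a≢c)) zs∈ y∈)
        ... | yes refl = b , x∈p∧x≢y⇒x∈p-y b∈ (a≢b ∘ sym)
                       , walkIn-snoc (walkIn-fromVertex p zs∈ y∈) vb (∖-mono (S⊆Ext {zs}) (x∈p∧x≢y⇒x∈p-y b∈ (a≢b ∘ sym)))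

        hub : ∃ λ h → h ∈ S ∖ c
        hub with a ≟ c
        ... | no a≢c   = a , x∈p∧x≢y⇒x∈p-y a∈ a≢c
        ... | yes refl = b , x∈p∧x≢y⇒x∈p-y b∈ (a≢b ∘ sym)

        toHub : ∀ {y} → y ∈ Ext zs ∖ c → WalkIn adj (Ext zs ∖ c) y (proj₁ hub)
        toHub y∈ with x∈p-y⁻ y∈
        ... | y∈Ext , y≢c with Ext⁻ y∈Ext
        ...   | inj₁ y∈S  = walkIn-mono (∖-mono (S⊆Ext {zs})) (block-noCut blk c c∈ (x∈p∧x≢y⇒x∈p-y y∈S y≢c) (proj₂ hub))
        ...   | inj₂ y∈zs with escape y∈zs
        ...     | e , e∈ , y⇝e = y⇝e ◅◅ⁱ walkIn-mono (∖-mono (S⊆Ext {zs})) (block-noCut blk c c∈ e∈ (proj₂ hub))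

      -- Deleting a path vertex c: the path splits at its unique occurrence of c into two
      -- pieces, attached to S at a and at b respectively.
      noCut-zs : ∀ {zs c} → Walk a zs v → Unique zs → All (_∉ S) zs → c ∈ₗ zs → ConnectedIn adj (Ext zs ∖ c)
      noCut-zs {c = c} p unique outside c∈zs with ∈-∃++ c∈zs
      ... | pre , post , refl with unique-middle pre unique | splitWalk pre p
      ...   | c∉pre , c∉post | _ , p₁ , _ ◅ p₂ = connectedIn-viaHub toA
        where
        S⊆ : S ⊆ Ext (pre ++ c ∷ post) ∖ c
        S⊆ y∈ = x∈p∧x≢y⇒x∈p-y (S⊆Ext {pre ++ c ∷ post} y∈) λ { refl → All.lookup outside c∈zs y∈ }

        pre∈ : All (_∈ Ext (pre ++ c ∷ post) ∖ c) pre
        pre∈ = All.tabulate λ y∈ → x∈p∧x≢y⇒x∈p-y (zs⊆Ext (∈-++⁺ˡ y∈)) λ { refl → c∉pre y∈ }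

        post∈ : All (_∈ Ext (pre ++ c ∷ post) ∖ c) post
        post∈ = All.tabulate λ y∈ → x∈p∧x≢y⇒x∈p-y (zs⊆Ext (∈-++⁺ʳ pre (there y∈))) λ { refl → c∉post y∈ }

        toA : ∀ {y} → y ∈ Ext (pre ++ c ∷ post) ∖ c → WalkIn adj (Ext (pre ++ c ∷ post) ∖ c) y a
        toA y∈ with x∈p-y⁻ y∈
        ... | y∈Ext , y≢c with Ext⁻ y∈Ext
        ...   | inj₁ y∈S  = walkIn-mono S⊆ (block-connected blk y∈S a∈)
        ...   | inj₂ y∈zs with ∈-++⁻ pre {c ∷ post} y∈zs
        ...     | inj₁ y∈pre          = walkIn-reverse (walkIn-toVertex p₁ (S⊆ a∈) pre∈ y∈pre)
        ...     | inj₂ (here refl)    = ⊥-elim (y≢c refl)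
        ...     | inj₂ (there y∈post) =
          walkIn-snoc (walkIn-fromVertex p₂ post∈ y∈post) vb (S⊆ b∈) ◅◅ⁱ walkIn-mono S⊆ (block-connected blk b∈ a∈)

      Ext⊆S : ∀ {zs} → Walk a zs v → Unique zs → All (_∉ S) zs → Ext zs ⊆ S
      Ext⊆S {zs} p unique outside = block-maximal blk (S⊆Ext {zs}) (connected p) noCut
        where
        noCut : NoCutVertexIn adj (Ext zs)
        noCut c c∈ with Ext⁻ c∈
        ... | inj₁ c∈S  = noCut-S p outside c∈S
        ... | inj₂ c∈zs = noCut-zs p unique outside c∈zs

  noEar : ∀ {S a b xs v} → IsBlock adj S → a ∈ S → b ∈ S → a ≢ b →
          Walk a xs v → All (_∉ S) xs → v ∉ S → Adj v b → ⊥
  noEar {S} blk a∈ b∈ a≢b p outside v∉ vb with shortcut p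
  ... | zs , p′ , _ ∷ unique , zs⊆ with walk-end p′
  ...   | inj₁ refl = v∉ a∈
  ...   | inj₂ v∈zs = v∉ (Detour.Ext⊆S blk a∈ b∈ a≢b vb p′ unique zs-outside (Detour.zs⊆Ext blk a∈ b∈ a≢b vb v∈zs))
    where
    zs-outside : All (_∉ S) zs
    zs-outside = All.tabulate (All.lookup outside ∘ zs⊆)

  noDetour : ∀ {S a w zs c} → IsBlock adj S → a ∈ S → Adj a w → w ∉ S →
             Walk w zs c → c ∈ S → All (_≢ a) zs → ⊥
  noDetour {S} {a} blk a∈ aw w∉ = outsideUntil (aw ◅ ε) (w∉ ∷ []) w∉
    where
    outsideUntil : ∀ {xs v zs c} → Walk a xs v → All (_∉ S) xs → v ∉ S →
                   Walk v zs c → c ∈ S → All (_≢ a) zs → ⊥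
    outsideUntil p outside v∉ ε c∈ _ = v∉ c∈
    outsideUntil p outside v∉ (_◅_ {w = b} vb q) c∈ (b≢a ∷ rest) with b ∈ˢ? S
    ... | yes b∈ = noEar blk a∈ b∈ (b≢a ∘ sym) p outside v∉ vb
    ... | no  b∉ = outsideUntil (p ◅◅ (vb ◅ ε)) (All-++⁺ outside (b∉ ∷ [])) b∉ q c∈ rest

  private
    Biconnected : Subset N → Set
    Biconnected T = ConnectedIn adj T × NoCutVertexIn adj T

    Maximal : Subset N → Set
    Maximal M = ∀ T → M ⊆ T → ConnectedIn adj T → NoCutVertexIn adj T → T ⊆ M

    ¬¬-maximalExtension : ∀ f {S} → N ≤ ∣ S ∣ + f → Biconnected S →
                          ¬ ¬ (∃ λ M → S ⊆ M × Biconnected M × Maximal M)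
    ¬¬-maximalExtension f {S} bound bic ¬ext = ¬¬-excluded-middle {A = ∃ λ T → S ⊂ T × Biconnected T} λ where
        (no ¬larger) → ¬ext (S , ⊆-refl , bic , λ T S⊆T conn noCut {x} x∈T →
          decidable-stable (x ∈ˢ? S) λ x∉S → ¬larger (T , (S⊆T , x , x∈T , x∉S) , conn , noCut))
        (yes (T , S⊂T , bicT)) → grow f bound S⊂T bicT
      where
      grow : ∀ f {T} → N ≤ ∣ S ∣ + f → S ⊂ T → Biconnected T → ⊥
      grow zero {T} bound S⊂T _ =
        <-irrefl refl (≤-trans (p⊂q⇒∣p∣<∣q∣ S⊂T) (≤-trans (∣p∣≤n T) (≤-trans bound (≤-reflexive (ℕ.+-identityʳ _)))))
      grow (suc f) bound S⊂T bicT =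
        ¬¬-maximalExtension f (≤-trans bound (≤-trans (≤-reflexive (+-suc _ f)) (+-monoˡ-≤ f (p⊂q⇒∣p∣<∣q∣ S⊂T)))) bicT
          λ (M , T⊆M , bicM , maxM) → ¬ext (M , T⊆M ∘ proj₁ S⊂T , bicM , maxM)

  ¬¬-inBlock : ∀ {S} → Nonempty S → ConnectedIn adj S → NoCutVertexIn adj S → ¬ ¬ (∃ λ B → IsBlock adj B × S ⊆ B)
  ¬¬-inBlock {S} (x , x∈) conn noCut ¬B = ¬¬-maximalExtension N (m≤n+m N ∣ S ∣) (conn , noCut)
    λ (M , S⊆M , (connM , noCutM) , maxM) → ¬B (M , ((x , S⊆M x∈) , connM , noCutM , maxM) , S⊆M)

  edge-connectedIn : ∀ {u v T} → Adj u v → T ⊆ ⁅ u ⁆ ∪ ⁅ v ⁆ → ConnectedIn adj T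
  edge-connectedIn {u} {v} a T⊆ y∈ z∈ with endpoint (T⊆ y∈) | endpoint (T⊆ z∈)
    where
    endpoint : ∀ {x} → x ∈ ⁅ u ⁆ ∪ ⁅ v ⁆ → x ≡ u ⊎ x ≡ v
    endpoint x∈ with x∈p∪q⁻ ⁅ u ⁆ ⁅ v ⁆ x∈
    ... | inj₁ x∈u = inj₁ (x∈⁅y⁆⇒x≡y u x∈u)
    ... | inj₂ x∈v = inj₂ (x∈⁅y⁆⇒x≡y v x∈v)
  ... | inj₁ refl | inj₁ refl = here y∈
  ... | inj₁ refl | inj₂ refl = step y∈ a (here z∈)
  ... | inj₂ refl | inj₁ refl = step y∈ (adj-sym a) (here z∈)
  ... | inj₂ refl | inj₂ refl = here y∈

  ¬¬-edgeInBlock : ∀ {u v} → Adj u v → ¬ ¬ (∃ λ B → IsBlock adj B × u ∈ B × v ∈ B)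
  ¬¬-edgeInBlock {u} {v} a ¬B =
    ¬¬-inBlock (u , x∈p∪q⁺ (inj₁ (x∈⁅x⁆ u))) (edge-connectedIn a ⊆-refl) (λ c _ → edge-connectedIn a (p─q⊆p _ _))
      λ (B , blk , pair⊆B) → ¬B (B , blk , pair⊆B (x∈p∪q⁺ (inj₁ (x∈⁅x⁆ u))) , pair⊆B (x∈p∪q⁺ (inj₂ (x∈⁅x⁆ v))))

-- `dist` runs a search loop local to its definition, which cannot be named here. Unfolding one
-- step separates the loop's fuel N₀ from the vertex count suc N₀; abstracting both, and the
-- start 1, leaves a pattern equation that solves the metavariable `loop`.
dist-isLeastSearch : ∀ {N₀} (adj : Fin (suc N₀) → Fin (suc N₀) → Bool) u v →
  Σ (ℕ → ℕ → ℕ) λ g → IsLeastSearch (λ k → reach adj k u v) g × dist adj u v ≡ g (suc N₀) 0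
dist-isLeastSearch {N₀} adj u v with unfolded N₀ adj u v
  where
  loop : ∀ {M} → (Fin M → Fin M → Bool) → Fin M → Fin M → ℕ → ℕ → ℕ
  loop = _

  unfolded : ∀ N₁ (adj : Fin (suc N₁) → Fin (suc N₁) → Bool) u v →
    Σ (ℕ → ℕ → ℕ) λ g → IsLeastSearch (λ k → reach adj k u v) g
                      × dist adj u v ≡ (if reach adj 0 u v then 0 else g N₁ 1)
  unfolded N₁ with N₁ | suc N₁ | 1
  ... | _ | _ | _ = λ adj u v → loop adj u v , record { exhausted = λ _ → refl ; next = λ _ _ → refl } , refl
... | g , isSearch , unfold = g , isSearch , trans unfold (sym (IsLeastSearch.next isSearch N₀ 0))

module Distance {N₀ : ℕ} {adj : Fin (suc N₀) → Fin (suc N₀) → Bool} (connected : Connected adj) (ρ : Fin (suc N₀)) where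
  open Walks adj

  d : Fin (suc N₀) → ℕ
  d x = dist adj x ρ

  d-least : ∀ {x k} → Reach k x ρ → d x ≤ k
  d-least {x} (reached r) with dist-isLeastSearch adj x ρ
  ... | g , isSearch , eq rewrite eq = LeastSearch.search-least isSearch (suc N₀) z≤n r

  d-reached : ∀ x → Reach (d x) x ρ
  d-reached x with dist-isLeastSearch adj x ρ | fromWalkIn (connected x ρ)
  ... | g , isSearch , eq | _ , p , _ with shortcut p
  ...   | ys , p′ , unique , _ rewrite eq =
    reached (LeastSearch.search-found isSearch (suc N₀) 0 (subst (λ k → T (reach adj k x ρ)) (sym (ℕ.+-identityʳ (suc N₀)))
      (Reach.reached? (walk⇒reach p′ (m≤n⇒m≤1+n (≤-pred (unique-length≤ unique)))))))

  d-root : d ρ ≡ 0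
  d-root = n≤0⇒n≡0 (d-least (reach-refl 0 ρ))

  d≡0⇒root : ∀ {x} → d x ≡ 0 → x ≡ ρ
  d≡0⇒root {x} dx≡0 = reach-zero⁻ (subst (λ k → Reach k x ρ) dx≡0 (d-reached x))

  d-adj : ∀ {u v} → Adj u v → d u ≤ suc (d v)
  d-adj {v = v} a = d-least (reach-cons (d v) a (d-reached v))

  closerNeighbour : ∀ {x} → x ≢ ρ → ∃ λ w → Adj x w × suc (d w) ≡ d x
  closerNeighbour {x} x≢ρ with reach⇒walk (d x) (d-reached x)
  ... | [] , ε , _ = ⊥-elim (x≢ρ refl)
  ... | w ∷ xs , a ◅ p , len =
    w , a , ≤-antisym (≤-trans (s≤s (d-least (walk⇒reach p ≤-refl))) len) (d-adj a)

  descent : ∀ x → ∃ λ xs → Walk x xs ρ × All (λ y → d y < d x) xs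
  descent x = descentFrom (d x) x refl
    where
    descentFrom : ∀ n x → d x ≡ n → ∃ λ xs → Walk x xs ρ × All (λ y → d y < d x) xs
    descentFrom zero x dx≡0 with d≡0⇒root dx≡0
    ... | refl = [] , ε , []
    descentFrom (suc n) x dx≡ with closerNeighbour {x} (λ { refl → 0≢1+n (trans (sym d-root) dx≡) })
    ... | w , a , dw< with descentFrom n w (suc-injective (trans dw< dx≡))
    ...   | xs , p , below = w ∷ xs , a ◅ p , ≤-reflexive dw< ∷ All.map (λ y< → <-trans y< (≤-reflexive dw<)) below

completeBipartite-swap : ∀ {N} {adj : Fin N → Fin N → Bool} {P Q} →
                         IsCompleteBipartiteOn adj P Q → IsCompleteBipartiteOn adj Q P
completeBipartite-swap {P = P} {Q} (disjoint , adj⇔) =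
  (λ v v∈Q v∈P → disjoint v v∈P v∈Q) ,
  λ u v u∈ v∈ → mk⇔ (Sum.swap ∘ to (adj⇔ u v (flip u∈) (flip v∈))) (from (adj⇔ u v (flip u∈) (flip v∈)) ∘ Sum.swap)
  where
  flip : ∀ {x} → x ∈ Q ∪ P → x ∈ P ∪ Q
  flip {x} = subst (x ∈_) (∪-comm Q P)

record SidedBlock {N : ℕ} (d : Fin N → ℕ) (c : Fin N) (P Q : Subset N) : Set where
  field
    c∈P      : c ∈ P
    d-far    : ∀ {v} → v ∈ Q → d v ≡ suc (d c)
    d-near   : ∀ {v} → v ∈ P → v ≢ c → d v ≡ suc (suc (d c))

-- `nearest k` is meant to be the vertex of block k closest to the root ρ.
record RootedBlockLayout {N r : ℕ} (X Y : Fin r → Subset N) (d : Fin N → ℕ) (ρ : Fin N) : Set where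
  field
    d-root        : d ρ ≡ 0
    nearest       : Fin r → Fin N
    sided         : ∀ k → SidedBlock d (nearest k) (X k) (Y k) ⊎ SidedBlock d (nearest k) (Y k) (X k)
    root-orphan   : ∀ k → ρ ∉ (X k ∪ Y k) ∖ nearest k
    parent        : ∀ {v} → v ≢ ρ → ∃ λ k → v ∈ (X k ∪ Y k) ∖ nearest k
    parent-unique : ∀ {v k l} → v ∈ (X k ∪ Y k) ∖ nearest k → v ∈ (X l ∪ Y l) ∖ nearest l → k ≡ l

module BiBlock {N₀ r : ℕ} {adj : Fin (suc N₀) → Fin (suc N₀) → Bool} {X Y : Fin r → Subset (suc N₀)}
               (G : IsBiBlockGraph adj r X Y) (ρ : Fin (suc N₀)) where
  open IsBiBlockGraph G
  open IsSimpleGraph simple using (symmetric)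
  open Walks adj
  open UndirectedWalks symmetric
  open Blocks symmetric
  open Distance connected ρ

  B : Fin r → Subset (suc N₀)
  B k = X k ∪ Y k

  nearest : Fin r → Fin (suc N₀)
  nearest k = argmin d (proj₁ (block-nonempty (blockIsBlk k))) (filter (_∈ˢ? B k) (allFin _))

  nearest∈ : ∀ k → nearest k ∈ B k
  nearest∈ k = argmin-all d (proj₂ (block-nonempty (blockIsBlk k))) (all-filter (_∈ˢ? B k) (allFin _))

  nearest-min : ∀ k {v} → v ∈ B k → d (nearest k) ≤ d v
  nearest-min k v∈ = All.lookup (f[argmin]≤f[xs] _ _) (∈-filter⁺ (_∈ˢ? B k) (∈-allFin _) v∈)

  -- Otherwise descending from w to ρ and climbing back to `nearest k` re-enters the block
  -- without passing through u.
  exit⇒nearest : ∀ k {u w} → u ∈ B k → w ∉ B k → Adj u w → d w < d u → u ≡ nearest k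
  exit⇒nearest k {u} {w} u∈ w∉ a dw<du = decidable-stable (u ≟ nearest k) ¬¬u≡c
    where
    ¬¬u≡c : ¬ ¬ (u ≡ nearest k)
    ¬¬u≡c u≢c with descent w | descent (nearest k)
    ... | xs , p , below | xs′ , p′ , below′ with reverseWalk p′
    ...   | ys , q , ys⊆ = noDetour (blockIsBlk k) u∈ a w∉ (p ◅◅ q) (nearest∈ k) (All.tabulate avoid)
      where
      avoid : ∀ {y} → y ∈ₗ xs ++ ys → y ≢ u
      avoid y∈ refl with ∈-++⁻ xs y∈
      ... | inj₁ u∈xs = <-irrefl refl (<-trans (All.lookup below u∈xs) dw<du)
      ... | inj₂ u∈ys with ys⊆ u∈ys
      ...   | here u≡c    = u≢c u≡c
      ...   | there u∈xs′ = <-irrefl refl (<-≤-trans (All.lookup below′ u∈xs′) (nearest-min k u∈))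

  nearest-root : ∀ k → ρ ∈ B k → nearest k ≡ ρ
  nearest-root k ρ∈ = d≡0⇒root (n≤0⇒n≡0 (subst (d (nearest k) ≤_) d-root (nearest-min k ρ∈)))

  descendInBlock : ∀ k {v} → v ∈ B k → v ≢ nearest k → ∃ λ w → w ∈ B k × Adj v w × suc (d w) ≡ d v
  descendInBlock k {v} v∈ v≢c with closerNeighbour {v} (λ { refl → v≢c (sym (nearest-root k v∈)) })
  ... | w , a , dw< with w ∈ˢ? B k
  ...   | yes w∈ = w , w∈ , a , dw<
  ...   | no  w∉ = ⊥-elim (v≢c (exit⇒nearest k v∈ w∉ a (≤-reflexive dw<)))

  parent-unique : ∀ {v k l} → v ∈ B k ∖ nearest k → v ∈ B l ∖ nearest l → k ≡ l
  parent-unique {v} {k} {l} v∈k v∈l with x∈p-y⁻ v∈k | x∈p-y⁻ v∈l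
  ... | v∈Bk , v≢ck | v∈Bl , v≢cl with descendInBlock l v∈Bl v≢cl
  ...   | w , w∈Bl , a , dw< with w ∈ˢ? B k
  ...     | no  w∉Bk = ⊥-elim (v≢ck (exit⇒nearest k v∈Bk w∉Bk a (≤-reflexive dw<)))
  ...     | yes w∈Bk = distinct k l (twoSharedVertices⇒≡ (blockIsBlk k) (blockIsBlk l) v≢w v∈Bk w∈Bk v∈Bl w∈Bl)
    where
    v≢w : v ≢ w
    v≢w refl = <-irrefl refl (≤-reflexive dw<)

  ¬¬-edgeInSomeBlock : ∀ {v w} → Adj v w → ¬ ¬ (∃ λ k → v ∈ B k × w ∈ B k)
  ¬¬-edgeInSomeBlock a ¬k = ¬¬-edgeInBlock a λ (S , blk , v∈ , w∈) → ¬k (inList (allBlocks S blk) v∈ w∈)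
    where
    inList : ∀ {S v w} → ∃ (λ k → S ≡ B k) → v ∈ S → w ∈ S → ∃ λ k → v ∈ B k × w ∈ B k
    inList (k , refl) v∈ w∈ = k , v∈ , w∈

  parent : ∀ {v} → v ≢ ρ → ∃ λ k → v ∈ B k ∖ nearest k
  parent {v} v≢ρ with closerNeighbour v≢ρ
  ... | w , a , dw< with decidable-stable (any? λ k → (v ∈ˢ? B k) ×-dec (w ∈ˢ? B k)) (¬¬-edgeInSomeBlock a)
  ...   | k , v∈ , w∈ = k , x∈p∧x≢y⇒x∈p-y v∈ λ { refl → <-irrefl refl (<-≤-trans (≤-reflexive dw<) (nearest-min k w∈)) }

  sidedBlock : ∀ k {P Q} → IsCompleteBipartiteOn adj P Q → P ∪ Q ≡ B k → nearest k ∈ P →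
               SidedBlock d (nearest k) P Q
  sidedBlock k {P} {Q} (disjoint , adj⇔) PQ≡B c∈P =
    record { c∈P = c∈P ; d-far = d-far ; d-near = d-near }
    where
    inB : ∀ {v} → v ∈ P ∪ Q → v ∈ B k
    inB {v} = subst (v ∈_) PQ≡B

    d-far : ∀ {v} → v ∈ Q → d v ≡ suc (d (nearest k))
    d-far {v} v∈Q with descendInBlock k (inB (x∈p∪q⁺ (inj₂ v∈Q))) (λ { refl → disjoint _ c∈P v∈Q })
    ... | w , w∈ , _ , dw< =
      ≤-antisym (d-adj (from (adj⇔ v _ (x∈p∪q⁺ (inj₂ v∈Q)) (x∈p∪q⁺ (inj₁ c∈P))) (inj₂ (v∈Q , c∈P))))
                (subst (suc (d (nearest k)) ≤_) dw< (s≤s (nearest-min k w∈)))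

    d-near : ∀ {v} → v ∈ P → v ≢ nearest k → d v ≡ suc (suc (d (nearest k)))
    d-near {v} v∈P v≢c with descendInBlock k (inB (x∈p∪q⁺ (inj₁ v∈P))) v≢c
    ... | w , w∈ , a , dw< with to (adj⇔ v w (x∈p∪q⁺ (inj₁ v∈P)) (subst (w ∈_) (sym PQ≡B) w∈)) a
    ...   | inj₁ (_ , w∈Q) = trans (sym dw<) (cong suc (d-far w∈Q))
    ...   | inj₂ (v∈Q , _) = ⊥-elim (disjoint _ v∈P v∈Q)

  layout : RootedBlockLayout X Y d ρ
  layout = record
    { d-root        = d-root
    ; nearest       = nearest
    ; sided         = sided
    ; root-orphan   = λ k ρ∈ → proj₂ (x∈p-y⁻ ρ∈) (sym (nearest-root k (proj₁ (x∈p-y⁻ ρ∈))))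
    ; parent        = parent
    ; parent-unique = parent-unique
    }
    where
    sided : ∀ k → SidedBlock d (nearest k) (X k) (Y k) ⊎ SidedBlock d (nearest k) (Y k) (X k)
    sided k with x∈p∪q⁻ (X k) (Y k) (nearest∈ k)
    ... | inj₁ c∈X = inj₁ (sidedBlock k (blockBip k) refl c∈X)
    ... | inj₂ c∈Y = inj₂ (sidedBlock k (completeBipartite-swap (blockBip k)) (∪-comm (Y k) (X k)) c∈Y)

module Indicators {c ℓ : Level} (F : Field c ℓ) where
  open Field F hiding (zero) renaming (refl to ≈-refl; sym to ≈-sym; trans to ≈-trans; reflexive to ≈-reflexive)
  open FieldDefs F
  open import Algebra.Properties.Semiring.Sum semiring public using (sum; sum-syntax; sum-cong-≋; ∑-distrib-+; ∑-comm; *-distribˡ-sum)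
  open import Relation.Binary.Reasoning.Setoid setoid

  Σᶠ≡sum : ∀ {n} (f : Fin n → Carrier) → Σᶠ f ≡ sum f
  Σᶠ≡sum {zero}  f = refl
  Σᶠ≡sum {suc n} f = cong (f zero +_) (Σᶠ≡sum (f ∘ suc))

  sum-neg : ∀ {n} (f : Fin n → Carrier) → ∑[ i < n ] (- f i) ≈ - sum f
  sum-neg f = begin
    ∑[ i < _ ] (- f i)      ≈⟨ sum-cong-≋ (λ i → ≈-sym (-1*x≈-x (f i))) ⟩
    ∑[ i < _ ] (- 1# * f i) ≈⟨ *-distribˡ-sum (- 1#) f ⟨
    - 1# * sum f            ≈⟨ -1*x≈-x (sum f) ⟩
    - sum f                 ∎
    where open import Algebra.Properties.Ring ring using (-1*x≈-x)

  when∈-∈ : ∀ {n} {S : Subset n} {v} a → v ∈ S → when∈ v S a ≡ a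
  when∈-∈ {S = S} {v} a v∈ with Data.Vec.lookup S v | []=⇒lookup v∈
  ... | .true | refl = refl

  when∈-∉ : ∀ {n} {S : Subset n} {v} a → v ∉ S → when∈ v S a ≡ 0#
  when∈-∉ {S = S} {v} a v∉ with Data.Vec.lookup S v in eq
  ... | true  = ⊥-elim (v∉ (lookup⇒[]= v S eq))
  ... | false = refl

  when∈-suc : ∀ {n} s (S : Subset n) i a → when∈ (suc i) (s ∷ S) a ≡ when∈ i S a
  when∈-suc s S i a with Data.Vec.lookup S i
  ... | true  = refl
  ... | false = refl

  *-when∈ : ∀ {n} v (S : Subset n) x a → x * when∈ v S a ≈ when∈ v S (x * a)
  *-when∈ v S x a with v ∈ˢ? S
  ... | yes v∈ rewrite when∈-∈ a v∈ | when∈-∈ (x * a) v∈ = ≈-refl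
  ... | no  v∉ rewrite when∈-∉ a v∉ | when∈-∉ (x * a) v∉ = zeroʳ x

  when∈-transfer : ∀ {n m} {S : Subset n} {S′ : Subset m} {x y} a →
                   (x ∈ S → y ∈ S′) → (y ∈ S′ → x ∈ S) → when∈ x S a ≡ when∈ y S′ a
  when∈-transfer {S = S} {S′} {x} {y} a to′ from′ with x ∈ˢ? S | y ∈ˢ? S′
  ... | yes x∈ | yes y∈ = trans (when∈-∈ a x∈) (sym (when∈-∈ a y∈))
  ... | yes x∈ | no  y∉ = ⊥-elim (y∉ (to′ x∈))
  ... | no  x∉ | yes y∈ = ⊥-elim (x∉ (from′ y∈))
  ... | no  x∉ | no  y∉ = trans (when∈-∉ a x∉) (sym (when∈-∉ a y∉))

  when∈-split : ∀ {n} {S : Subset n} {c v} a → c ∈ S → when∈ v S a ≈ when∈ v ⁅ c ⁆ a + when∈ v (S ∖ c) a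
  when∈-split {S = S} {c} {v} a c∈ with v ≟ c | v ∈ˢ? S
  ... | yes refl | _ = begin
    when∈ c S a                          ≡⟨ when∈-∈ a c∈ ⟩
    a                                    ≈⟨ +-identityʳ a ⟨
    a + 0#                               ≡⟨ sym (cong₂ _+_ (when∈-∈ a (x∈⁅x⁆ c)) (when∈-∉ {S = S ∖ c} a λ c∈S∖c → proj₂ (x∈p-y⁻ c∈S∖c) refl)) ⟩
    when∈ c ⁅ c ⁆ a + when∈ c (S ∖ c) a  ∎
  ... | no v≢c | yes v∈ = begin
    when∈ v S a                          ≡⟨ when∈-∈ a v∈ ⟩
    a                                    ≈⟨ +-identityˡ a ⟨
    0# + a                               ≡⟨ sym (cong₂ _+_ (when∈-∉ {S = ⁅ c ⁆} a (v≢c ∘ x∈⁅y⁆⇒x≡y c)) (when∈-∈ {S = S ∖ c} a (x∈p∧x≢y⇒x∈p-y v∈ v≢c))) ⟩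
    when∈ v ⁅ c ⁆ a + when∈ v (S ∖ c) a  ∎
  ... | no v≢c | no v∉ = begin
    when∈ v S a                          ≡⟨ when∈-∉ a v∉ ⟩
    0#                                   ≈⟨ +-identityˡ 0# ⟨
    0# + 0#                              ≡⟨ sym (cong₂ _+_ (when∈-∉ {S = ⁅ c ⁆} a (v≢c ∘ x∈⁅y⁆⇒x≡y c)) (when∈-∉ {S = S ∖ c} a (v∉ ∘ proj₁ ∘ x∈p-y⁻))) ⟩
    when∈ v ⁅ c ⁆ a + when∈ v (S ∖ c) a  ∎

  sum-when∈ : ∀ {n} (S : Subset n) {f : Fin n → Carrier} {a} → (∀ {v} → v ∈ S → f v ≈ a) →
              ∑[ v < n ] when∈ v S (f v) ≈ natF ∣ S ∣ * a
  sum-when∈ []           {a = a} _  = ≈-sym (zeroˡ a)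
  sum-when∈ (true ∷ S)  {f} {a} f≈ = begin
    f zero + ∑[ i < _ ] when∈ (suc i) (true ∷ S) (f (suc i)) ≈⟨ +-cong (f≈ here) (sum-cong-≋ λ i → ≈-reflexive (when∈-suc true S i _)) ⟩
    a + ∑[ i < _ ] when∈ i S (f (suc i))                      ≈⟨ +-congˡ (sum-when∈ S (f≈ ∘ there)) ⟩
    a + natF ∣ S ∣ * a                                        ≈⟨ +-congʳ (*-identityˡ a) ⟨
    1# * a + natF ∣ S ∣ * a                                   ≈⟨ distribʳ a 1# (natF ∣ S ∣) ⟨
    (1# + natF ∣ S ∣) * a                                     ∎
  sum-when∈ (false ∷ S) {f} {a} f≈ = begin
    0# + ∑[ i < _ ] when∈ (suc i) (false ∷ S) (f (suc i)) ≈⟨ +-identityˡ _ ⟩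
    ∑[ i < _ ] when∈ (suc i) (false ∷ S) (f (suc i))      ≈⟨ sum-cong-≋ (λ i → ≈-reflexive (when∈-suc false S i _)) ⟩
    ∑[ i < _ ] when∈ i S (f (suc i))                       ≈⟨ sum-when∈ S (f≈ ∘ there) ⟩
    natF ∣ S ∣ * a                                         ∎

  sum-when∈-⁅⁆ : ∀ {n} (c : Fin n) (f : Fin n → Carrier) → ∑[ v < n ] when∈ v ⁅ c ⁆ (f v) ≈ f c
  sum-when∈-⁅⁆ c f = begin
    ∑[ v < _ ] when∈ v ⁅ c ⁆ (f v) ≈⟨ sum-when∈ ⁅ c ⁆ (λ v∈ → ≈-reflexive (cong f (x∈⁅y⁆⇒x≡y c v∈))) ⟩
    natF ∣ ⁅ c ⁆ ∣ * f c           ≡⟨ cong (λ k → natF k * f c) (∣⁅x⁆∣≡1 c) ⟩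
    (1# + 0#) * f c                ≈⟨ *-congʳ (+-identityʳ 1#) ⟩
    1# * f c                       ≈⟨ *-identityˡ (f c) ⟩
    f c                            ∎

  sum-when∈-split : ∀ {n} {S : Subset n} {c} (f : Fin n → Carrier) → c ∈ S →
                    ∑[ v < n ] when∈ v S (f v) ≈ f c + ∑[ v < n ] when∈ v (S ∖ c) (f v)
  sum-when∈-split {S = S} {c} f c∈ = begin
    ∑[ v < _ ] when∈ v S (f v)                                          ≈⟨ sum-cong-≋ (λ v → when∈-split (f v) c∈) ⟩
    ∑[ v < _ ] (when∈ v ⁅ c ⁆ (f v) + when∈ v (S ∖ c) (f v))            ≈⟨ ∑-distrib-+ (λ v → when∈ v ⁅ c ⁆ (f v)) (λ v → when∈ v (S ∖ c) (f v)) ⟩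
    ∑[ v < _ ] when∈ v ⁅ c ⁆ (f v) + ∑[ v < _ ] when∈ v (S ∖ c) (f v) ≈⟨ +-congʳ (sum-when∈-⁅⁆ c f) ⟩
    f c + ∑[ v < _ ] when∈ v (S ∖ c) (f v)                              ∎

  natF∣p-x∣≈∣p∣-1 : ∀ {n} {S : Subset n} {c} → c ∈ S → natF ∣ S ∖ c ∣ ≈ natF ∣ S ∣ - 1#
  natF∣p-x∣≈∣p∣-1 {S = S} {c} c∈ = begin
    natF ∣ S ∖ c ∣                     ≈⟨ xyx⁻¹≈y 1# _ ⟨
    1# + (natF ∣ S ∖ c ∣) - 1#         ≈⟨ +-congʳ size ⟨
    (natF ∣ S ∣) - 1#                  ∎
    where
    open import Algebra.Properties.AbelianGroup +-abelianGroup using (xyx⁻¹≈y)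
    size : natF ∣ S ∣ ≈ 1# + natF ∣ S ∖ c ∣
    size = begin
      natF ∣ S ∣                         ≈⟨ *-identityʳ _ ⟨
      natF ∣ S ∣ * 1#                    ≈⟨ sum-when∈ S (λ _ → ≈-refl) ⟨
      ∑[ v < _ ] when∈ v S 1#            ≈⟨ sum-when∈-split (λ _ → 1#) c∈ ⟩
      1# + ∑[ v < _ ] when∈ v (S ∖ c) 1# ≈⟨ +-congˡ (sum-when∈ (S ∖ c) (λ _ → ≈-refl)) ⟩
      1# + natF ∣ S ∖ c ∣ * 1#           ≈⟨ +-congˡ (*-identityʳ _) ⟩
      1# + natF ∣ S ∖ c ∣                ∎

  natF-countIn : ∀ {N r} (S : Fin r → Subset N) v → natF (countIn S v) ≈ ∑[ k < r ] when∈ v (S k) 1#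
  natF-countIn {r = zero}  S v = ≈-refl
  natF-countIn {r = suc r} S v with Data.Vec.lookup (S zero) v
  ... | true  = +-congˡ (natF-countIn (S ∘ suc) v)
  ... | false = ≈-trans (natF-countIn (S ∘ suc) v) (≈-sym (+-identityˡ _))

module WeightedSum {c ℓ : Level} (F : Field c ℓ) where
  open Field F hiding (zero) renaming (refl to ≈-refl; sym to ≈-sym; trans to ≈-trans; reflexive to ≈-reflexive)
  open FieldDefs F
  open Indicators F
  open import Algebra.Definitions.RawSemiring (Algebra.Bundles.Semiring.rawSemiring semiring) using (_^_)
  open import Algebra.Properties.AbelianGroup +-abelianGroup using (xyx⁻¹≈y; ⁻¹-anti-homo‿-)
  open import Algebra.Properties.Monoid.Sum +-monoid using (sum-replicate-zero)
  open import Algebra.Solver.Ring.NaturalCoefficients.Default commutativeSemiring using (solve; _:=_; _:+_; _:*_; con)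
  open import Relation.Binary.Reasoning.Setoid setoid

  -- The semiring solver cannot cancel, so -1 is given to it as an indeterminate t; an identity
  -- that needs 1 + t ≈ 0 is stated with an explicit multiple of 1 + t.
  t : Carrier
  t = - 1#

  mod-1+t : ∀ {x y} k → x ≈ y + k * (1# + t) → x ≈ y
  mod-1+t {x} {y} k x≈ = begin
    x                ≈⟨ x≈ ⟩
    y + k * (1# + t) ≈⟨ +-congˡ (≈-trans (*-congˡ (-‿inverseʳ 1#)) (zeroʳ k)) ⟩
    y + 0#           ≈⟨ +-identityʳ y ⟩
    y                ∎

  qnum-coefficient : ∀ q a → 1# + q + (q * q - 1#) * qnum q a ≈ (q + 1#) * q ^ a
  qnum-coefficient q zero =
    solve 2 (λ q t → con 1 :+ q :+ (q :* q :+ t) :* con 0 := (q :+ con 1) :* con 1) ≈-refl q t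
  qnum-coefficient q (suc a) = begin
    1# + q + (q * q - 1#) * (1# + q * qnum q a)  ≈⟨ mod-1+t 1# (solve 3 (λ q x t →
        con 1 :+ q :+ (q :* q :+ t) :* (con 1 :+ q :* x) := q :* (con 1 :+ q :+ (q :* q :+ t) :* x) :+ con 1 :* (con 1 :+ t))
        ≈-refl q (qnum q a) t) ⟩
    q * (1# + q + (q * q - 1#) * qnum q a)       ≈⟨ *-congˡ (qnum-coefficient q a) ⟩
    q * ((q + 1#) * q ^ a)                       ≈⟨ x∙yz≈y∙xz q (q + 1#) (q ^ a) ⟩
    (q + 1#) * q ^ suc a                         ∎
    where open import Algebra.Properties.CommutativeSemigroup *-commutativeSemigroup using (x∙yz≈y∙xz)

  x≉0∧y≉0⇒x*y≉0 : ∀ {x y} → ¬ (x ≈ 0#) → ¬ (y ≈ 0#) → ¬ (x * y ≈ 0#)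
  x≉0∧y≉0⇒x*y≉0 {x} {y} x≉0 y≉0 xy≈0 = y≉0 (begin
    y                ≈⟨ *-identityˡ y ⟨
    1# * y           ≈⟨ *-congʳ (≈-trans (*-comm (x ⁻¹) x) (⁻¹-inverse x x≉0)) ⟨
    x ⁻¹ * x * y     ≈⟨ *-assoc (x ⁻¹) x y ⟩
    x ⁻¹ * (x * y)   ≈⟨ *-congˡ xy≈0 ⟩
    x ⁻¹ * 0#        ≈⟨ zeroʳ (x ⁻¹) ⟩
    0#               ∎)

  q+1*Δ≉0 : ∀ q {N r} (X Y : Fin r → Subset N) k → ¬ (q ≈ - 1#) →
             ¬ (q * q * (m q X Y k - 1#) * (n q X Y k - 1#) ≈ 1#) → ¬ ((q + 1#) * Δ q X Y k ≈ 0#)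
  q+1*Δ≉0 q X Y k q≉-1 nondegenerate =
    x≉0∧y≉0⇒x*y≉0 (q≉-1 ∘ inverseˡ-unique q 1#) (nondegenerate ∘ x∙y⁻¹≈ε⇒x≈y _ 1#)
    where open import Algebra.Properties.Group +-group using (inverseˡ-unique; x∙y⁻¹≈ε⇒x≈y)

  balance-near-first : ∀ q C m n w →
    C * ((q * (n - 1#) - 1#) * w) + (m - 1#) * (q * (q * C) * ((q * (n - 1#) - 1#) * w))
      + n * (q * C * ((q * (m - 1#) - 1#) * w))
    ≈ C * ((q + 1#) * (q * q * (m - 1#) * (n - 1#) - 1#) * w)
  balance-near-first q C m n w = mod-1+t (C * q * n * w) (solve 6 (λ C q m n w t →
      C :* ((q :* (n :+ t) :+ t) :* w) :+ (m :+ t) :* (q :* (q :* C) :* ((q :* (n :+ t) :+ t) :* w))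
        :+ n :* (q :* C :* ((q :* (m :+ t) :+ t) :* w))
    := C :* ((q :+ con 1) :* (q :* q :* (m :+ t) :* (n :+ t) :+ t) :* w) :+ C :* q :* n :* w :* (con 1 :+ t))
    ≈-refl C q m n w t)

  balance-far-first : ∀ q C m n w →
    m * (q * C * ((q * (n - 1#) - 1#) * w))
      + (C * ((q * (m - 1#) - 1#) * w) + (n - 1#) * (q * (q * C) * ((q * (m - 1#) - 1#) * w)))
    ≈ C * ((q + 1#) * (q * q * (m - 1#) * (n - 1#) - 1#) * w)
  balance-far-first q C m n w = mod-1+t (C * q * m * w) (solve 6 (λ C q m n w t →
      m :* (q :* C :* ((q :* (n :+ t) :+ t) :* w))
        :+ (C :* ((q :* (m :+ t) :+ t) :* w) :+ (n :+ t) :* (q :* (q :* C) :* ((q :* (m :+ t) :+ t) :* w)))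
    := C :* ((q :+ con 1) :* (q :* q :* (m :+ t) :* (n :+ t) :+ t) :* w) :+ C :* q :* m :* w :* (con 1 :+ t))
    ≈-refl C q m n w t)

  module _ (q : Carrier) {N : ℕ} (d : Fin N → ℕ) {c P Q} (B : SidedBlock d c P Q) where
    open SidedBlock B

    sum-near : ∀ a → ∑[ v < N ] (q ^ d v * when∈ v P a) ≈ q ^ d c * a + (natF ∣ P ∣ - 1#) * (q * (q * q ^ d c) * a)
    sum-near a = begin
      ∑[ v < N ] (q ^ d v * when∈ v P a)                    ≈⟨ sum-cong-≋ (λ v → *-when∈ v P (q ^ d v) a) ⟩
      ∑[ v < N ] when∈ v P (q ^ d v * a)                    ≈⟨ sum-when∈-split (λ v → q ^ d v * a) c∈P ⟩
      q ^ d c * a + ∑[ v < N ] when∈ v (P ∖ c) (q ^ d v * a) ≈⟨ +-congˡ (sum-when∈ (P ∖ c) two-steps-away) ⟩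
      q ^ d c * a + natF ∣ P ∖ c ∣ * (q * (q * q ^ d c) * a) ≈⟨ +-congˡ (*-congʳ (natF∣p-x∣≈∣p∣-1 c∈P)) ⟩
      q ^ d c * a + (natF ∣ P ∣ - 1#) * (q * (q * q ^ d c) * a) ∎
      where
      two-steps-away : ∀ {v} → v ∈ P ∖ c → q ^ d v * a ≈ q * (q * q ^ d c) * a
      two-steps-away v∈ with x∈p-y⁻ v∈
      ... | v∈P , v≢c = ≈-reflexive (cong (λ e → q ^ e * a) (d-near v∈P v≢c))

    sum-far : ∀ b → ∑[ v < N ] (q ^ d v * when∈ v Q b) ≈ natF ∣ Q ∣ * (q * q ^ d c * b)
    sum-far b = begin
      ∑[ v < N ] (q ^ d v * when∈ v Q b) ≈⟨ sum-cong-≋ (λ v → *-when∈ v Q (q ^ d v) b) ⟩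
      ∑[ v < N ] when∈ v Q (q ^ d v * b) ≈⟨ sum-when∈ Q (λ v∈Q → ≈-reflexive (cong (λ e → q ^ e * b) (d-far v∈Q))) ⟩
      natF ∣ Q ∣ * (q * q ^ d c * b)     ∎

  module _ (q : Carrier) {N r : ℕ} {X Y : Fin r → Subset N} {d : Fin N → ℕ} {ρ : Fin N}
           (L : RootedBlockLayout X Y d ρ) (invertible : ∀ k → ¬ ((q + 1#) * Δ q X Y k ≈ 0#)) where
    open RootedBlockLayout L
    open import Algebra.Properties.Ring ring using (-0#≈0#; -‿distribʳ-*)

    w α β : Fin r → Carrier
    w k = ((q + 1#) * Δ q X Y k) ⁻¹
    α k = (q * (n q X Y k - 1#) - 1#) * w k
    β k = (q * (m q X Y k - 1#) - 1#) * w k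

    block-sum : ∀ k → ∑[ v < N ] (q ^ d v * (when∈ v (X k) (α k) + when∈ v (Y k) (β k))) ≈ q ^ d (nearest k)
    block-sum k = begin
      ∑[ v < N ] (q ^ d v * (when∈ v (X k) (α k) + when∈ v (Y k) (β k)))
        ≈⟨ sum-cong-≋ (λ v → distribˡ (q ^ d v) _ _) ⟩
      ∑[ v < N ] (q ^ d v * when∈ v (X k) (α k) + q ^ d v * when∈ v (Y k) (β k))
        ≈⟨ ∑-distrib-+ (λ v → q ^ d v * when∈ v (X k) (α k)) (λ v → q ^ d v * when∈ v (Y k) (β k)) ⟩
      ∑[ v < N ] (q ^ d v * when∈ v (X k) (α k)) + ∑[ v < N ] (q ^ d v * when∈ v (Y k) (β k))
        ≈⟨ bySide (sided k) ⟩
      C * ((q + 1#) * Δ q X Y k * w k)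
        ≈⟨ *-congˡ (⁻¹-inverse _ (invertible k)) ⟩
      C * 1#
        ≈⟨ *-identityʳ C ⟩
      C ∎
      where
      C mₖ nₖ : Carrier
      C = q ^ d (nearest k)
      mₖ = m q X Y k
      nₖ = n q X Y k

      bySide : SidedBlock d (nearest k) (X k) (Y k) ⊎ SidedBlock d (nearest k) (Y k) (X k) →
               ∑[ v < N ] (q ^ d v * when∈ v (X k) (α k)) + ∑[ v < N ] (q ^ d v * when∈ v (Y k) (β k))
                 ≈ C * ((q + 1#) * Δ q X Y k * w k)
      bySide (inj₁ B) = ≈-trans (+-cong (sum-near q d B (α k)) (sum-far q d B (β k))) (balance-near-first q C mₖ nₖ (w k))
      bySide (inj₂ B) = ≈-trans (+-cong (sum-far q d B (α k)) (sum-near q d B (β k))) (balance-far-first q C mₖ nₖ (w k))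

    nearest∈ : ∀ k → nearest k ∈ X k ∪ Y k
    nearest∈ k with sided k
    ... | inj₁ B = x∈p∪q⁺ (inj₁ (SidedBlock.c∈P B))
    ... | inj₂ B = x∈p∪q⁺ (inj₂ (SidedBlock.c∈P B))

    parents-count : ∀ v → ∑[ k < r ] when∈ v ((X k ∪ Y k) ∖ nearest k) 1# ≈ 1# - when∈ v ⁅ ρ ⁆ 1#
    parents-count v with v ≟ ρ
    ... | yes refl = begin
      ∑[ k < r ] when∈ ρ ((X k ∪ Y k) ∖ nearest k) 1# ≈⟨ sum-cong-≋ (λ k → ≈-reflexive (when∈-∉ 1# (root-orphan k))) ⟩
      ∑[ k < r ] 0#                                    ≈⟨ sum-replicate-zero r ⟩
      0#                                               ≈⟨ -‿inverseʳ 1# ⟨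
      1# - 1#                                          ≡⟨ cong (λ x → 1# - x) (when∈-∈ 1# (x∈⁅x⁆ ρ)) ⟨
      1# - when∈ ρ ⁅ ρ ⁆ 1#                            ∎
    ... | no v≢ρ with parent v≢ρ
    ...   | k₀ , v∈ = begin
      ∑[ k < r ] when∈ v ((X k ∪ Y k) ∖ nearest k) 1# ≈⟨ sum-cong-≋ (λ k → ≈-reflexive (when∈-transfer 1# (only-parent k) (is-parent k))) ⟩
      ∑[ k < r ] when∈ k ⁅ k₀ ⁆ 1#                     ≈⟨ sum-when∈-⁅⁆ k₀ (λ _ → 1#) ⟩
      1#                                               ≈⟨ +-identityʳ 1# ⟨
      1# + 0#                                          ≈⟨ +-congˡ -0#≈0# ⟨
      1# - 0#                                          ≡⟨ cong (λ x → 1# - x) (when∈-∉ 1# (v≢ρ ∘ x∈⁅y⁆⇒x≡y ρ)) ⟨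
      1# - when∈ v ⁅ ρ ⁆ 1#                            ∎
      where
      only-parent : ∀ k → v ∈ (X k ∪ Y k) ∖ nearest k → k ∈ ⁅ k₀ ⁆
      only-parent k v∈k = subst (_∈ ⁅ k₀ ⁆) (parent-unique v∈ v∈k) (x∈⁅x⁆ k₀)
      is-parent : ∀ k → k ∈ ⁅ k₀ ⁆ → v ∈ (X k ∪ Y k) ∖ nearest k
      is-parent k k∈ with x∈⁅y⁆⇒x≡y k₀ k∈
      ... | refl = v∈

    degree-pred : ∀ v → natF (dhat q X Y v) - 1# ≈ ∑[ k < r ] when∈ v ⁅ nearest k ⁆ 1# - when∈ v ⁅ ρ ⁆ 1#
    degree-pred v = begin
      natF (dhat q X Y v) - 1#
        ≈⟨ +-congʳ (natF-countIn (λ k → X k ∪ Y k) v) ⟩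
      ∑[ k < r ] when∈ v (X k ∪ Y k) 1# - 1#
        ≈⟨ +-congʳ (sum-cong-≋ (λ k → when∈-split 1# (nearest∈ k))) ⟩
      ∑[ k < r ] (when∈ v ⁅ nearest k ⁆ 1# + when∈ v ((X k ∪ Y k) ∖ nearest k) 1#) - 1#
        ≈⟨ +-congʳ (∑-distrib-+ (λ k → when∈ v ⁅ nearest k ⁆ 1#) (λ k → when∈ v ((X k ∪ Y k) ∖ nearest k) 1#)) ⟩
      Cv + ∑[ k < r ] when∈ v ((X k ∪ Y k) ∖ nearest k) 1# - 1#
        ≈⟨ +-congʳ (+-congˡ (parents-count v)) ⟩
      Cv + (1# - ρv) - 1#
        ≈⟨ mod-1+t 1# (solve 3 (λ C x t → C :+ (con 1 :+ x) :+ t := C :+ x :+ con 1 :* (con 1 :+ t)) ≈-refl Cv (- ρv) t) ⟩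
      Cv - ρv ∎
      where
      Cv ρv : Carrier
      Cv = ∑[ k < r ] when∈ v ⁅ nearest k ⁆ 1#
      ρv = when∈ v ⁅ ρ ⁆ 1#

    sum-blocks : ∑[ v < N ] (q ^ d v * (Σᶠ (λ k → when∈ v (X k) (α k)) + Σᶠ (λ k → when∈ v (Y k) (β k))))
                   ≈ ∑[ k < r ] (q ^ d (nearest k))
    sum-blocks = begin
      ∑[ v < N ] (q ^ d v * (Σᶠ (λ k → A v k) + Σᶠ (λ k → B v k)))
        ≈⟨ sum-cong-≋ (λ v → *-congˡ (≈-reflexive (cong₂ _+_ (Σᶠ≡sum (A v)) (Σᶠ≡sum (B v))))) ⟩
      ∑[ v < N ] (q ^ d v * (sum (A v) + sum (B v)))
        ≈⟨ sum-cong-≋ (λ v → *-congˡ (∑-distrib-+ (A v) (B v))) ⟨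
      ∑[ v < N ] (q ^ d v * ∑[ k < r ] (A v k + B v k))
        ≈⟨ sum-cong-≋ (λ v → *-distribˡ-sum (q ^ d v) (λ k → A v k + B v k)) ⟩
      ∑[ v < N ] ∑[ k < r ] (q ^ d v * (A v k + B v k))
        ≈⟨ ∑-comm (λ v k → q ^ d v * (A v k + B v k)) ⟩
      ∑[ k < r ] ∑[ v < N ] (q ^ d v * (A v k + B v k))
        ≈⟨ sum-cong-≋ block-sum ⟩
      ∑[ k < r ] (q ^ d (nearest k)) ∎
      where
      A B : Fin N → Fin r → Carrier
      A v k = when∈ v (X k) (α k)
      B v k = when∈ v (Y k) (β k)

    sum-nearest : ∑[ v < N ] (q ^ d v * ∑[ k < r ] when∈ v ⁅ nearest k ⁆ 1#) ≈ ∑[ k < r ] (q ^ d (nearest k))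
    sum-nearest = begin
      ∑[ v < N ] (q ^ d v * ∑[ k < r ] when∈ v ⁅ nearest k ⁆ 1#)
        ≈⟨ sum-cong-≋ (λ v → *-distribˡ-sum (q ^ d v) (λ k → when∈ v ⁅ nearest k ⁆ 1#)) ⟩
      ∑[ v < N ] ∑[ k < r ] (q ^ d v * when∈ v ⁅ nearest k ⁆ 1#)
        ≈⟨ ∑-comm (λ v k → q ^ d v * when∈ v ⁅ nearest k ⁆ 1#) ⟩
      ∑[ k < r ] ∑[ v < N ] (q ^ d v * when∈ v ⁅ nearest k ⁆ 1#)
        ≈⟨ sum-cong-≋ (λ k → sum-cong-≋ (λ v → *-when∈ v ⁅ nearest k ⁆ (q ^ d v) 1#)) ⟩
      ∑[ k < r ] ∑[ v < N ] when∈ v ⁅ nearest k ⁆ (q ^ d v * 1#)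
        ≈⟨ sum-cong-≋ (λ k → sum-when∈-⁅⁆ (nearest k) (λ v → q ^ d v * 1#)) ⟩
      ∑[ k < r ] (q ^ d (nearest k) * 1#)
        ≈⟨ sum-cong-≋ (λ k → *-identityʳ (q ^ d (nearest k))) ⟩
      ∑[ k < r ] (q ^ d (nearest k)) ∎

    sum-root : ∑[ v < N ] (q ^ d v * when∈ v ⁅ ρ ⁆ 1#) ≈ 1#
    sum-root = begin
      ∑[ v < N ] (q ^ d v * when∈ v ⁅ ρ ⁆ 1#) ≈⟨ sum-cong-≋ (λ v → *-when∈ v ⁅ ρ ⁆ (q ^ d v) 1#) ⟩
      ∑[ v < N ] when∈ v ⁅ ρ ⁆ (q ^ d v * 1#) ≈⟨ sum-when∈-⁅⁆ ρ (λ v → q ^ d v * 1#) ⟩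
      q ^ d ρ * 1#                           ≡⟨ cong (λ e → q ^ e * 1#) d-root ⟩
      1# * 1#                                ≈⟨ *-identityʳ 1# ⟩
      1#                                     ∎

    weighted-xvec : ∀ v → q ^ d v * xvec q X Y v
                    ≈ q ^ d v * (Σᶠ (λ k → when∈ v (X k) (α k)) + Σᶠ (λ k → when∈ v (Y k) (β k)))
                      + q ^ d v * when∈ v ⁅ ρ ⁆ 1# - q ^ d v * ∑[ k < r ] when∈ v ⁅ nearest k ⁆ 1#
    weighted-xvec v = begin
      Q * (E - (natF (dhat q X Y v) - 1#)) ≈⟨ *-congˡ (+-congˡ (-‿cong (degree-pred v))) ⟩
      Q * (E - (C - R))                    ≈⟨ *-congˡ (+-congˡ (⁻¹-anti-homo‿- C R)) ⟩
      Q * (E + (R - C))                    ≈⟨ solve 4 (λ Q E R x → Q :* (E :+ (R :+ x)) := Q :* E :+ Q :* R :+ Q :* x) ≈-refl Q E R (- C) ⟩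
      Q * E + Q * R + Q * - C              ≈⟨ +-congˡ (-‿distribʳ-* Q C) ⟨
      Q * E + Q * R - Q * C                ∎
      where
      Q E C R : Carrier
      Q = q ^ d v
      E = Σᶠ (λ k → when∈ v (X k) (α k)) + Σᶠ (λ k → when∈ v (Y k) (β k))
      C = ∑[ k < r ] when∈ v ⁅ nearest k ⁆ 1#
      R = when∈ v ⁅ ρ ⁆ 1#

    weighted-sum : ∑[ v < N ] (q ^ d v * xvec q X Y v) ≈ 1#
    weighted-sum = begin
      ∑[ v < N ] (q ^ d v * xvec q X Y v)                  ≈⟨ sum-cong-≋ weighted-xvec ⟩
      ∑[ v < N ] (QE v + QR v - QC v)                      ≈⟨ ∑-distrib-+ (λ v → QE v + QR v) (λ v → - QC v) ⟩
      ∑[ v < N ] (QE v + QR v) + ∑[ v < N ] (- QC v)       ≈⟨ +-cong (∑-distrib-+ QE QR) (sum-neg QC) ⟩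
      sum QE + sum QR - sum QC                             ≈⟨ +-cong (+-cong sum-blocks sum-root) (-‿cong sum-nearest) ⟩
      Σc + 1# - Σc                                         ≈⟨ xyx⁻¹≈y Σc 1# ⟩
      1#                                                   ∎
      where
      QE QR QC : Fin N → Carrier
      QE v = q ^ d v * (Σᶠ (λ k → when∈ v (X k) (α k)) + Σᶠ (λ k → when∈ v (Y k) (β k)))
      QR v = q ^ d v * when∈ v ⁅ ρ ⁆ 1#
      QC v = q ^ d v * ∑[ k < r ] when∈ v ⁅ nearest k ⁆ 1#
      Σc = ∑[ k < r ] (q ^ d (nearest k))

lemma4p1 : ∀ {c ℓ : Level} (F : Field c ℓ) (N₀ : ℕ)
    (adj : Fin (suc N₀) → Fin (suc N₀) → Bool)
    (r : ℕ) (X Y : Fin r → Subset (suc N₀)) →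
    IsBiBlockGraph adj r X Y →
    let open Field F
        open FieldDefs F
        last = fromℕ N₀
    in (q : Carrier) →
    ¬ (q ≈ - 1#) →
    (∀ k → ¬ (q * q * (m q X Y k - 1#) * (n q X Y k - 1#) ≈ 1#)) →
    Σᶠ (λ i → (1# + q + (q * q - 1#) * qnum q (dist adj i last)) * xvec q X Y i)
      ≈ q + 1#
lemma4p1 F N₀ adj r X Y G q q≉-1 nondegenerate = begin
  Σᶠ (λ i → (1# + q + (q * q - 1#) * qnum q (d i)) * xvec q X Y i)
    ≡⟨ Σᶠ≡sum (λ i → (1# + q + (q * q - 1#) * qnum q (d i)) * xvec q X Y i) ⟩
  ∑[ i < suc N₀ ] ((1# + q + (q * q - 1#) * qnum q (d i)) * xvec q X Y i)
    ≈⟨ sum-cong-≋ (λ i → ≈-trans (*-congʳ (qnum-coefficient q (d i))) (*-assoc (q + 1#) (q ^ d i) (xvec q X Y i))) ⟩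
  ∑[ i < suc N₀ ] ((q + 1#) * (q ^ d i * xvec q X Y i))
    ≈⟨ *-distribˡ-sum (q + 1#) (λ i → q ^ d i * xvec q X Y i) ⟨
  (q + 1#) * ∑[ i < suc N₀ ] (q ^ d i * xvec q X Y i)
    ≈⟨ *-congˡ (weighted-sum q (BiBlock.layout G (fromℕ N₀)) λ k → q+1*Δ≉0 q X Y k q≉-1 (nondegenerate k)) ⟩
  (q + 1#) * 1#
    ≈⟨ *-identityʳ (q + 1#) ⟩
  q + 1# ∎
  where
  open Field F hiding (zero) renaming (trans to ≈-trans)
  open FieldDefs F
  open Indicators F
  open WeightedSum F
  open import Algebra.Definitions.RawSemiring (Algebra.Bundles.Semiring.rawSemiring semiring) using (_^_)
  open import Relation.Binary.Reasoning.Setoid setoid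

  d : Fin (suc N₀) → ℕ
  d i = dist adj i (fromℕ N₀)
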